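{- For all $\alpha,\beta\in S(132)$, the direct product $\alpha\otimes\beta$ is again in $S(132)$.
   Context: $S(132)=\bigcup_n S_n(132)$, where $S_n(132)$ is the set of permutations of $[n]$ avoiding the pattern $132$. For a permutation $\sigma$ and integers $a,b$: $\sigma^{+a}$ adds $a$ to every entry; $\sigma^{a\rtimes b}$ adds $b$ to every entry $\ge a$; $\sigma(x\ldots y)=\sigma(x)\sigma(x+1)\cdots\sigma(y)$; a dot denotes concatenation. For $\beta\in S_n$, $T(\beta)=\{i\in[n]:\beta^{ -1}(i)>i\text{ and }\beta(i)>i\}$. For $\alpha\in S_m(132)$, $\beta\in S_n(132)$ and $k=1+|T(\beta)|$, the direct product is $\alpha\otimes\beta=\beta^{k\rtimes m}(1\ldots k-1).\alpha^{+(k-1)}.\beta^{k\rtimes m}(k\ldots n)$. -}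

module Defs where

open import Data.Nat using (ℕ; zero; suc; _+_; _∸_; _≤_; _<_; _≤?_; _<?_; _≟_)
open import Data.Nat.Properties using ()
open import Data.List using (List; []; _∷_; length; map; filter; upTo; take; drop; _++_; lookup)
open import Data.List.Relation.Binary.Permutation.Propositional using (_↭_)
open import Data.Fin using (Fin; toℕ)
open import Data.Bool using (if_then_else_)
open import Data.Product using (Σ; _×_; ∃-syntax)
open import Relation.Nullary using (¬_; Dec; yes; no)
open import Relation.Nullary.Decidable using (⌊_⌋; _×-dec_)
open import Relation.Binary.PropositionalEquality using (_≡_)

-- Permutations are lists in one-line notation: σ = σ(1) σ(2) ... σ(n).

[1‥_] : ℕ → List ℕ
[1‥ n ] = map suc (upTo n)

IsPerm : ℕ → List ℕ → Set
IsPerm n σ = σ ↭ [1‥ n ]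

Contains132 : List ℕ → Set
Contains132 σ = ∃[ i ] ∃[ j ] ∃[ k ]
  (toℕ i < toℕ j × toℕ j < toℕ k ×
   lookup σ i < lookup σ k × lookup σ k < lookup σ j)

Avoids132 : List ℕ → Set
Avoids132 σ = ¬ Contains132 σ

InS132 : ℕ → List ℕ → Set
InS132 n σ = IsPerm n σ × Avoids132 σ

-- σ(i) for 1-based i (0 if out of range)
_at_ : List ℕ → ℕ → ℕ
[] at _ = 0
(x ∷ xs) at zero = 0
(x ∷ xs) at suc zero = x
(x ∷ xs) at suc (suc i) = xs at suc i

-- σ⁻¹(v): 1-based position of v in σ (for a permutation, the inverse)
inv : List ℕ → ℕ → ℕ
inv [] v = 0
inv (x ∷ xs) v with x ≟ v
... | yes _ = 1
... | no _ = suc (inv xs v)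

T : List ℕ → List ℕ
T β = filter (λ i → i <? inv β i ×-dec i <? (β at i)) [1‥ length β ]

plus : ℕ → List ℕ → List ℕ
plus a σ = map (λ x → x + a) σ

shiftFrom : ℕ → ℕ → List ℕ → List ℕ
shiftFrom a b σ = map (λ x → if ⌊ a ≤? x ⌋ then x + b else x) σ

_⊗_ : List ℕ → List ℕ → List ℕ
α ⊗ β = take (k ∸ 1) β' ++ plus (k ∸ 1) α ++ drop (k ∸ 1) β'
  where
  m = length α
  k = suc (length (T β))
  β' = shiftFrom k m β

module Submission where

-- Write t = |T(β)|, M = |α| and β′ = β^{(t+1)⋊M}, so that α ⊗ β = P ++ A ++ S with
-- P = β′(1…t), A = α^{+t} and S = β′(t+1…n).
--  * Occurrences of 132 are handled by positions (Occurs132, the language of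
--    Contains132 and of T(β)) and as subsequences (Pattern, the language in which a
--    list is cut into blocks); the two views are converted into each other first.
--  * Gluing: A ++ S avoids 132 if A and S do, the values of S avoid the range of A and
--    the values of S above that range increase (glue₂); putting a block P on top of
--    A keeps avoidance as long as P ++ S avoids 132 (glue).
--  * Structure of T(β): for a 132-avoiding permutation β, i ∈ T(β) iff the first i
--    entries of β all exceed i.  This is downward closed, so T(β) = {1, …, t}
--    (T-run); hence the first t entries of β exceed t (run⇒exceeds) and after
--    position t the entries exceeding t increase (run⇒noDescent).
--  * The product cut at an arbitrary t ≤ n is a permutation of [m + n] (splice-perm),
--    and it avoids 132 whenever the two properties of t above hold (splice-avoids);
--    the theorem applies both to t = |T(β)|.

open import Defs
open import Data.Nat using (ℕ; zero; suc; _+_; _∸_; _≤_; _<_; _≤?_; _<?_; _≟_; z≤n; s≤s)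
open import Data.Nat.Properties
open import Data.Bool using (if_then_else_)
open import Data.Fin using (Fin; toℕ; fromℕ<) renaming (zero to fzero; suc to fsuc)
open import Data.Fin.Properties using (toℕ<n; toℕ-fromℕ<)
open import Data.List using (List; []; _∷_; length; map; filter; upTo; applyUpTo; take; drop; _++_; lookup)
open import Data.List.Properties using (take-map; take++drop≡id; length-map; length-upTo; map-upTo; map-++; ∷-injective)
open import Data.List.Membership.Propositional using (_∈_)
open import Data.List.Membership.Propositional.Properties using (∈-map⁺; ∈-map⁻; ∈-upTo⁺; ∈-upTo⁻)
open import Data.List.Relation.Unary.Any using (here; there)
open import Data.List.Relation.Unary.All as All using (All; []; _∷_)
import Data.List.Relation.Unary.All.Properties as AllP
open import Data.List.Relation.Unary.AllPairs using (_∷_)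
open import Data.List.Relation.Unary.Unique.Propositional using (Unique)
import Data.List.Relation.Unary.Unique.Propositional.Properties as UniqueP
open import Data.List.Relation.Binary.Sublist.Propositional using (_⊆_; []; _∷_; _∷ʳ_; minimum)
open import Data.List.Relation.Binary.Sublist.Propositional.Properties using (All-resp-⊆; ∷ˡ⁻)
import Data.List.Relation.Binary.Sublist.Propositional.Properties as Sublist
open import Data.List.Relation.Binary.Permutation.Propositional using (_↭_; ↭-sym; ↭⇒↭ₛ; module PermutationReasoning)
open import Data.List.Relation.Binary.Permutation.Propositional.Properties using (↭-length; ∈-resp-↭; shifts)
import Data.List.Relation.Binary.Permutation.Propositional.Properties as Perm
import Data.List.Relation.Binary.Permutation.Setoid.Properties as SetoidPerm
open import Data.Product using (_×_; _,_; proj₂; ∃-syntax)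
open import Data.Sum using (_⊎_; inj₁; inj₂)
open import Data.Empty using (⊥; ⊥-elim)
open import Function using (_∘_)
open import Relation.Nullary using (¬_; yes; no)
open import Relation.Nullary.Decidable using (⌊_⌋; _×-dec_)
open import Relation.Unary using (Decidable)
open import Relation.Binary using (tri<; tri≈; tri>)
open import Relation.Binary.PropositionalEquality
  using (_≡_; _≢_; refl; sym; trans; cong; cong₂; subst; subst₂; setoid; module ≡-Reasoning)

open SetoidPerm (setoid ℕ) using (Unique-resp-↭)

-- σ ‼ p is the entry of σ at the 0-based position p (0 when p is out of range).
_‼_ : List ℕ → ℕ → ℕ
σ ‼ p = σ at suc p

lookup-‼ : ∀ σ (i : Fin (length σ)) → lookup σ i ≡ σ ‼ toℕ i
lookup-‼ (x ∷ σ) fzero = refl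
lookup-‼ (x ∷ σ) (fsuc i) = lookup-‼ σ i

‼-map : ∀ (f : ℕ → ℕ) σ {p} → p < length σ → map f σ ‼ p ≡ f (σ ‼ p)
‼-map f (x ∷ σ) {zero} _ = refl
‼-map f (x ∷ σ) {suc p} (s≤s p<) = ‼-map f σ p<

‼-∈ : ∀ σ {p} → p < length σ → σ ‼ p ∈ σ
‼-∈ (x ∷ σ) {zero} _ = here refl
‼-∈ (x ∷ σ) {suc p} (s≤s p<) = there (‼-∈ σ p<)

‼-distinct : ∀ {σ p q} → Unique σ → p < q → q < length σ → σ ‼ p ≢ σ ‼ q
‼-distinct {x ∷ σ} {zero} {suc q} (x∉σ ∷ _) _ (s≤s q<) = All.lookup x∉σ (‼-∈ σ q<)
‼-distinct {x ∷ σ} {suc p} {suc q} (_ ∷ u) (s≤s p<q) (s≤s q<) = ‼-distinct u p<q q<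

inv-position : ∀ σ {v} → v ∈ σ → ∃[ p ] (inv σ v ≡ suc p × p < length σ × σ ‼ p ≡ v)
inv-position (x ∷ σ) {v} v∈ with x ≟ v
... | yes x≡v = 0 , refl , s≤s z≤n , x≡v
inv-position (x ∷ σ) (here refl) | no x≢v = ⊥-elim (x≢v refl)
inv-position (x ∷ σ) (there v∈) | no _ with p , e , p< , σp≡v ← inv-position σ v∈ =
  suc p , cong suc e , s≤s p< , σp≡v

Occurs132 : List ℕ → ℕ → ℕ → ℕ → Set
Occurs132 σ p q r = p < q × q < r × r < length σ × σ ‼ p < σ ‼ r × σ ‼ r < σ ‼ q

occurs⇒contains : ∀ σ {p q r} → Occurs132 σ p q r → Contains132 σ
occurs⇒contains σ {p} {q} {r} (p<q , q<r , r< , σp<σr , σr<σq) =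
  fromℕ< p< , fromℕ< q< , fromℕ< r< ,
  subst₂ _<_ (sym (toℕ-fromℕ< p<)) (sym (toℕ-fromℕ< q<)) p<q ,
  subst₂ _<_ (sym (toℕ-fromℕ< q<)) (sym (toℕ-fromℕ< r<)) q<r ,
  subst₂ _<_ (sym (entry p<)) (sym (entry r<)) σp<σr ,
  subst₂ _<_ (sym (entry r<)) (sym (entry q<)) σr<σq
  where
  q< = <-trans q<r r<
  p< = <-trans p<q q<
  entry : ∀ {i} (i< : i < length σ) → lookup σ (fromℕ< i<) ≡ σ ‼ i
  entry i< = trans (lookup-‼ σ (fromℕ< i<)) (cong (σ ‼_) (toℕ-fromℕ< i<))

contains⇒occurs : ∀ σ → Contains132 σ → ∃[ p ] ∃[ q ] ∃[ r ] Occurs132 σ p q r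
contains⇒occurs σ (i , j , k , i<j , j<k , σi<σk , σk<σj) =
  toℕ i , toℕ j , toℕ k , i<j , j<k , toℕ<n k ,
  subst₂ _<_ (lookup-‼ σ i) (lookup-‼ σ k) σi<σk ,
  subst₂ _<_ (lookup-‼ σ k) (lookup-‼ σ j) σk<σj

occurs-map⁻ : ∀ (f : ℕ → ℕ) σ {p q r} → (∀ {x y} → f x < f y → x < y) →
  Occurs132 (map f σ) p q r → Occurs132 σ p q r
occurs-map⁻ f σ {p} {q} {r} reflect (p<q , q<r , r< , lo , hi) =
  p<q , q<r , r<′ ,
  reflect (subst₂ _<_ (‼-map f σ p<) (‼-map f σ r<′) lo) ,
  reflect (subst₂ _<_ (‼-map f σ r<′) (‼-map f σ q<) hi)
  where
  r<′ = subst (r <_) (length-map f σ) r<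
  q< = <-trans q<r r<′
  p< = <-trans p<q q<

-- In a duplicate-free 132-avoiding list, every entry before a descent σ ‼ p > σ ‼ q
-- exceeds σ ‼ q; this is the only way avoidance of 132 enters the analysis of T(β).
before-descent : ∀ {σ s p q} → Unique σ → Avoids132 σ →
  s < p → p < q → q < length σ → σ ‼ q < σ ‼ p → σ ‼ q < σ ‼ s
before-descent {σ} {s} {p} {q} u av s<p p<q q< σq<σp with <-cmp (σ ‼ s) (σ ‼ q)
... | tri< σs<σq _ _ = ⊥-elim (av (occurs⇒contains σ (s<p , p<q , q< , σs<σq , σq<σp)))
... | tri≈ _ σs≡σq _ = ⊥-elim (‼-distinct u (<-trans s<p p<q) q< σs≡σq)
... | tri> _ _ σq<σs = σq<σs

Pattern : List ℕ → Set
Pattern σ = ∃[ a ] ∃[ b ] ∃[ c ] ((a ∷ c ∷ b ∷ []) ⊆ σ × a < b × b < c)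

cons-after : ∀ {ws} u p σ → u ≤ p → p < length σ → ws ⊆ drop (suc p) σ →
  (σ ‼ p ∷ ws) ⊆ drop u σ
cons-after zero zero (x ∷ σ) _ _ s = refl ∷ s
cons-after zero (suc p) (x ∷ σ) _ (s≤s p<) s = x ∷ʳ cons-after zero p σ z≤n p< s
cons-after (suc u) (suc p) (x ∷ σ) (s≤s u≤p) (s≤s p<) s = cons-after u p σ u≤p p< s

head-after : ∀ {x ws} u σ → (x ∷ ws) ⊆ drop u σ →
  ∃[ p ] (u ≤ p × p < length σ × σ ‼ p ≡ x × ws ⊆ drop (suc p) σ)
head-after zero (y ∷ σ) (refl ∷ s) = 0 , z≤n , s≤s z≤n , refl , s
head-after zero (y ∷ σ) (_ ∷ʳ s) with p , _ , p< , σp≡x , s′ ← head-after zero σ s =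
  suc p , z≤n , s≤s p< , σp≡x , s′
head-after (suc u) (y ∷ σ) s with p , u≤p , p< , σp≡x , s′ ← head-after u σ s =
  suc p , s≤s u≤p , s≤s p< , σp≡x , s′

occurs⇒pattern : ∀ σ {p q r} → Occurs132 σ p q r → Pattern σ
occurs⇒pattern σ {p} {q} {r} (p<q , q<r , r< , σp<σr , σr<σq) =
  σ ‼ p , σ ‼ r , σ ‼ q ,
  cons-after 0 p σ z≤n (<-trans p<q q<)
    (cons-after (suc p) q σ p<q q< (cons-after (suc q) r σ q<r r< (minimum _))) ,
  σp<σr , σr<σq
  where q< = <-trans q<r r<

pattern⇒occurs : ∀ σ → Pattern σ → ∃[ p ] ∃[ q ] ∃[ r ] Occurs132 σ p q r
pattern⇒occurs σ (a , b , c , s , a<b , b<c) with head-after 0 σ s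
... | p , _ , _ , refl , s₁ with head-after (suc p) σ s₁
... | q , p<q , _ , refl , s₂ with head-after (suc q) σ s₂
... | r , q<r , r< , refl , _ = p , q , r , p<q , q<r , r< , a<b , b<c

contains⇒pattern : ∀ {σ} → Contains132 σ → Pattern σ
contains⇒pattern {σ} c with _ , _ , _ , occ ← contains⇒occurs σ c = occurs⇒pattern σ occ

avoids-map : ∀ (f : ℕ → ℕ) {σ} → (∀ {x y} → f x < f y → x < y) →
  Avoids132 σ → ¬ Pattern (map f σ)
avoids-map f {σ} reflect av pat with _ , _ , _ , occ ← pattern⇒occurs (map f σ) pat =
  av (occurs⇒contains σ (occurs-map⁻ f σ reflect occ))

⊆-++⁻ : ∀ xs {ys ws : List ℕ} → ws ⊆ xs ++ ys →
  ∃[ w₁ ] ∃[ w₂ ] (w₁ ++ w₂ ≡ ws × w₁ ⊆ xs × w₂ ⊆ ys)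
⊆-++⁻ [] s = [] , _ , refl , [] , s
⊆-++⁻ (x ∷ xs) (_ ∷ʳ s) with w₁ , w₂ , e , s₁ , s₂ ← ⊆-++⁻ xs s =
  w₁ , w₂ , e , x ∷ʳ s₁ , s₂
⊆-++⁻ (x ∷ xs) (refl ∷ s) with w₁ , w₂ , e , s₁ , s₂ ← ⊆-++⁻ xs s =
  x ∷ w₁ , w₂ , cong (x ∷_) e , refl ∷ s₁ , s₂

skip-block : ∀ {Q : ℕ → Set} B {R ws} → All Q ws → All (¬_ ∘ Q) B → ws ⊆ B ++ R → ws ⊆ R
skip-block [] _ _ s = s
skip-block (y ∷ B) qs (_ ∷ ¬qB) (_ ∷ʳ s) = skip-block B qs ¬qB s
skip-block (y ∷ B) (qy ∷ _) (¬qy ∷ _) (refl ∷ s) = ⊥-elim (¬qy qy)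

gap-high : ∀ {lo hi b S} → All (λ x → x ≤ lo ⊎ hi < x) S → (b ∷ []) ⊆ S → lo < b → hi < b
gap-high out sS lo<b with All-resp-⊆ sS out
... | inj₁ b≤lo ∷ [] = ⊥-elim (≤⇒≯ b≤lo lo<b)
... | inj₂ hi<b ∷ [] = hi<b

glue₂ : ∀ {lo hi} A S → ¬ Pattern A → ¬ Pattern S →
  All (λ x → lo < x × x ≤ hi) A → All (λ x → x ≤ lo ⊎ hi < x) S →
  (∀ {c b} → (c ∷ b ∷ []) ⊆ S → hi < b → b < c → ⊥) →
  ¬ Pattern (A ++ S)
glue₂ A S noA noS mid out increasing (a , b , c , s , a<b , b<c) with ⊆-++⁻ A s
... | [] , _ , refl , _ , sS = noS (a , b , c , sS , a<b , b<c)
... | _ ∷ [] , _ , refl , sA , sS with (lo<a , _) ∷ [] ← All-resp-⊆ sA mid =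
  increasing sS (gap-high out (∷ˡ⁻ sS) (<-trans lo<a a<b)) b<c
... | _ ∷ _ ∷ [] , _ , refl , sA , sS with (lo<a , _) ∷ (_ , c≤hi) ∷ [] ← All-resp-⊆ sA mid =
  ≤⇒≯ c≤hi (<-trans (gap-high out sS (<-trans lo<a a<b)) b<c)
... | _ ∷ _ ∷ _ ∷ [] , _ , refl , sA , _ = noA (a , b , c , sA , a<b , b<c)

glue : ∀ {hi} P A S → ¬ Pattern (P ++ S) → ¬ Pattern (A ++ S) →
  All (hi <_) P → All (_≤ hi) A → ¬ Pattern (P ++ A ++ S)
glue {hi} P A S noPS noAS high low (a , b , c , s , a<b , b<c) with ⊆-++⁻ P s
... | [] , _ , refl , _ , s₂ = noAS (a , b , c , s₂ , a<b , b<c)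
-- The occurrence starts in P, so all its values exceed hi: it misses A and lies in P ++ S.
... | a′ ∷ w₁ , w₂ , e , s₁ , s₂ with refl , e′ ← ∷-injective e =
  noPS (a , b , c , subst (_⊆ P ++ S) e (Sublist.++⁺ s₁ (skip-block A w₂-high A-low s₂)) , a<b , b<c)
  where
  hi<a : hi < a
  hi<a with hi<a ∷ _ ← All-resp-⊆ s₁ high = hi<a
  w₂-high : All (hi <_) w₂
  w₂-high = AllP.++⁻ʳ w₁ (subst (All (hi <_)) (sym e′)
    (<-trans hi<a (<-trans a<b b<c) ∷ <-trans hi<a a<b ∷ []))
  A-low : All (¬_ ∘ (hi <_)) A
  A-low = All.map ≤⇒≯ low

perm-length : ∀ {σ n} → σ ↭ [1‥ n ] → length σ ≡ n
perm-length {n = n} σ↭ = trans (↭-length σ↭) (trans (length-map suc (upTo n)) (length-upTo n))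

perm-∈ : ∀ {σ n j} → σ ↭ [1‥ n ] → j < n → suc j ∈ σ
perm-∈ σ↭ j<n = ∈-resp-↭ (↭-sym σ↭) (∈-map⁺ suc (∈-upTo⁺ j<n))

perm-range : ∀ {σ n x} → σ ↭ [1‥ n ] → x ∈ σ → 0 < x × x ≤ n
perm-range σ↭ x∈σ with _ , i∈ , refl ← ∈-map⁻ suc (∈-resp-↭ σ↭ x∈σ) = s≤s z≤n , ∈-upTo⁻ i∈

perm-unique : ∀ {σ n} → σ ↭ [1‥ n ] → Unique σ
perm-unique {n = n} σ↭ =
  Unique-resp-↭ (↭⇒↭ₛ (↭-sym σ↭)) (UniqueP.map⁺ suc-injective (UniqueP.upTo⁺ n))

record InitialRun (Q : ℕ → Set) (n t : ℕ) : Set where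
  field
    bounded : t ≤ n
    inside  : ∀ {i} → i < t → Q i
    stops   : t < n → ¬ Q t

filter-initialRun : ∀ {P : ℕ → Set} (P? : Decidable P) f n →
  (∀ {i j} → j ≤ i → i < n → P (f i) → P (f j)) →
  InitialRun (P ∘ f) n (length (filter P? (applyUpTo f n)))
filter-initialRun P? f zero _ = record { bounded = z≤n ; inside = λ () ; stops = λ () }
filter-initialRun P? f (suc n) down with P? (f 0)
... | yes p = record
  { bounded = s≤s bounded
  ; inside  = λ { {zero} _ → p ; {suc i} (s≤s i<t) → inside i<t }
  ; stops   = λ { (s≤s t<n) → stops t<n }
  }
  where open InitialRun (filter-initialRun P? (f ∘ suc) n λ j≤i i<n → down (s≤s j≤i) (s≤s i<n))
... | no ¬p = record
  { bounded = m≤n⇒m≤1+n bounded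
  ; inside  = λ i<t → ⊥-elim (¬p (down z≤n (s≤s (<-≤-trans i<t bounded)) (inside i<t)))
  ; stops   = λ t<1+n → ¬p ∘ down z≤n t<1+n
  }
  where open InitialRun (filter-initialRun P? (f ∘ suc) n λ j≤i i<n → down (s≤s j≤i) (s≤s i<n))

InT : List ℕ → ℕ → Set
InT β i = i < inv β i × i < β at i

inT? : ∀ β → Decidable (InT β)
inT? β i = (i <? inv β i) ×-dec (i <? β at i)

Exceeds : List ℕ → ℕ → Set
Exceeds σ i = ∀ {p} → p < i → i < σ ‼ p

exceeds-antitone : ∀ {σ i j} → j ≤ i → Exceeds σ i → Exceeds σ j
exceeds-antitone j≤i ex p<j = ≤-<-trans j≤i (ex (<-≤-trans p<j j≤i))

exceeds⇒inT : ∀ {β j} → suc j ∈ β → Exceeds β (suc j) → InT β (suc j)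
exceeds⇒inT {β} {j} j∈β ex with p , inv≡ , _ , βp≡ ← inv-position β j∈β =
  subst (suc j <_) (sym inv≡) (s≤s j<p) , ex ≤-refl
  where
  j<p : j < p
  j<p = ≰⇒> λ p≤j → <-irrefl (sym βp≡) (ex (s≤s p≤j))

-- Conversely, in a 132-avoiding permutation: the i-th entry exceeds i = β ‼ q with q ≥ i,
-- so this descent forces every earlier entry above i as well.
inT⇒exceeds : ∀ {β j} → Unique β → Avoids132 β → suc j ∈ β → InT β (suc j) → Exceeds β (suc j)
inT⇒exceeds {β} {j} u av j∈β (j<inv , j<βj) {p} p≤j
  with q , inv≡ , q< , βq≡ ← inv-position β j∈β | m≤n⇒m<n∨m≡n (≤-pred p≤j)
... | inj₂ refl = j<βj
... | inj₁ p<j = subst (_< β ‼ p) βq≡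
  (before-descent u av p<j j<q q< (subst (_< β ‼ j) (sym βq≡) j<βj))
  where
  j<q : j < q
  j<q = ≤-pred (subst (suc j <_) inv≡ j<inv)

T-run : ∀ {n β} → β ↭ [1‥ n ] → Avoids132 β → InitialRun (InT β ∘ suc) n (length (T β))
T-run {n} {β} β↭ av = subst (InitialRun (InT β ∘ suc) n) (sym count)
  (filter-initialRun (inT? β) suc n down)
  where
  count : length (T β) ≡ length (filter (inT? β) (applyUpTo suc n))
  count = cong (length ∘ filter (inT? β)) (trans (cong [1‥_] (perm-length β↭)) (map-upTo suc n))
  down : ∀ {i j} → j ≤ i → i < n → InT β (suc i) → InT β (suc j)
  down j≤i i<n inT = exceeds⇒inT (perm-∈ β↭ (≤-<-trans j≤i i<n))
    (exceeds-antitone {β} (s≤s j≤i) (inT⇒exceeds (perm-unique β↭) av (perm-∈ β↭ i<n) inT))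

run⇒exceeds : ∀ {n β t} → β ↭ [1‥ n ] → Avoids132 β → InitialRun (InT β ∘ suc) n t → Exceeds β t
run⇒exceeds {t = zero} _ _ _ ()
run⇒exceeds {t = suc j} β↭ av run =
  inT⇒exceeds (perm-unique β↭) av (perm-∈ β↭ bounded) (inside ≤-refl)
  where open InitialRun run

NoDescentAbove : List ℕ → ℕ → Set
NoDescentAbove σ t = ∀ {p q} → t ≤ p → p < q → q < length σ → t < σ ‼ q → σ ‼ q < σ ‼ p → ⊥

-- Such a descent would put every entry up to position t above t + 1, extending the run.
run⇒noDescent : ∀ {n β t} → β ↭ [1‥ n ] → Avoids132 β → InitialRun (InT β ∘ suc) n t →
  NoDescentAbove β t
run⇒noDescent {n} {β} {t} β↭ av run {p} {q} t≤p p<q q< t<βq βq<βp =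
  stops t<n (exceeds⇒inT (perm-∈ β↭ t<n) exceeds)
  where
  open InitialRun run
  t<n : t < n
  t<n = subst (t <_) (perm-length β↭) (≤-<-trans t≤p (<-trans p<q q<))
  exceeds : Exceeds β (suc t)
  exceeds {s} s≤t with m≤n⇒m<n∨m≡n (≤-trans (≤-pred s≤t) t≤p)
  ... | inj₂ refl = ≤-<-trans t<βq βq<βp
  ... | inj₁ s<p = ≤-<-trans t<βq (before-descent (perm-unique β↭) av s<p p<q q< βq<βp)

interval : ℕ → ℕ → List ℕ
interval a zero = []
interval a (suc l) = suc a ∷ interval (suc a) l

applyUpTo-interval : ∀ (f : ℕ → ℕ) a n → (∀ i → f i ≡ suc (a + i)) → applyUpTo f n ≡ interval a n
applyUpTo-interval f a zero _ = refl
applyUpTo-interval f a (suc n) f≡ = cong₂ _∷_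
  (trans (f≡ 0) (cong suc (+-identityʳ a)))
  (applyUpTo-interval (f ∘ suc) (suc a) n λ i → trans (f≡ (suc i)) (cong suc (+-suc a i)))

[1‥]≡interval : ∀ n → [1‥ n ] ≡ interval 0 n
[1‥]≡interval n = trans (map-upTo suc n) (applyUpTo-interval suc 0 n λ _ → refl)

interval-++ : ∀ a x y → interval a (x + y) ≡ interval a x ++ interval (a + x) y
interval-++ a zero y = cong (λ b → interval b y) (sym (+-identityʳ a))
interval-++ a (suc x) y = cong (suc a ∷_) (trans (interval-++ (suc a) x y)
  (cong (λ b → interval (suc a) x ++ interval b y) (sym (+-suc a x))))

plus-interval : ∀ c a l → plus c (interval a l) ≡ interval (a + c) l
plus-interval c a zero = refl
plus-interval c a (suc l) = cong (suc (a + c) ∷_) (plus-interval c (suc a) l)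

-- raise t M adds M to the values above t; shiftFrom (t + 1) M is map (raise t M).
raise : ℕ → ℕ → ℕ → ℕ
raise t M x = if ⌊ suc t ≤? x ⌋ then x + M else x

raise-fix : ∀ {t M x} → x ≤ t → raise t M x ≡ x
raise-fix {t} {M} {x} x≤t with suc t ≤? x
... | yes t<x = ⊥-elim (≤⇒≯ x≤t t<x)
... | no _ = refl

raise-shift : ∀ {t M x} → t < x → raise t M x ≡ x + M
raise-shift {t} {M} {x} t<x with suc t ≤? x
... | yes _ = refl
... | no t≮x = ⊥-elim (t≮x t<x)

raise-low : ∀ {t M x} → x ≤ t → raise t M x ≤ t
raise-low x≤t = subst (_≤ _) (sym (raise-fix x≤t)) x≤t

raise-above : ∀ {t M x} → t < x → t + M < raise t M x
raise-above {t} {M} t<x = subst (t + M <_) (sym (raise-shift t<x)) (+-monoˡ-< M t<x)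

raise-gap : ∀ t M x → raise t M x ≤ t ⊎ t + M < raise t M x
raise-gap t M x with ≤-<-connex x t
... | inj₁ x≤t = inj₁ (raise-low x≤t)
... | inj₂ t<x = inj₂ (raise-above t<x)

raise-large : ∀ {t M x} → t + M < raise t M x → t < x
raise-large {t} {M} {x} M< with ≤-<-connex x t
... | inj₁ x≤t = ⊥-elim (≤⇒≯ (≤-trans (raise-low x≤t) (m≤m+n t M)) M<)
... | inj₂ t<x = t<x

raise-reflects-< : ∀ {t M x y} → raise t M x < raise t M y → x < y
raise-reflects-< {t} {M} {x} {y} r< with ≤-<-connex x t | ≤-<-connex y t
... | inj₁ x≤t | inj₁ y≤t = subst₂ _<_ (raise-fix x≤t) (raise-fix y≤t) r<
... | inj₁ x≤t | inj₂ t<y = ≤-<-trans x≤t t<y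
... | inj₂ t<x | inj₁ y≤t = ⊥-elim (≤⇒≯ (≤-trans (raise-low y≤t) (m≤m+n t M)) (<-trans (raise-above t<x) r<))
... | inj₂ t<x | inj₂ t<y = +-cancelʳ-< M x y (subst₂ _<_ (raise-shift t<x) (raise-shift t<y) r<)

raise-interval-fix : ∀ t M a l → a + l ≤ t → map (raise t M) (interval a l) ≡ interval a l
raise-interval-fix t M a zero _ = refl
raise-interval-fix t M a (suc l) a+l<t = cong₂ _∷_
  (raise-fix (≤-trans (m≤m+n (suc a) l) a+l<t′))
  (raise-interval-fix t M (suc a) l a+l<t′)
  where a+l<t′ = subst (_≤ t) (+-suc a l) a+l<t

raise-interval-shift : ∀ t M a l → t ≤ a → map (raise t M) (interval a l) ≡ interval (a + M) l
raise-interval-shift t M a zero _ = refl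
raise-interval-shift t M a (suc l) t≤a = cong₂ _∷_
  (raise-shift (s≤s t≤a))
  (raise-interval-shift t M (suc a) l (m≤n⇒m≤1+n t≤a))

raise-[1‥] : ∀ {t n} M → t ≤ n →
  map (raise t M) (interval 0 n) ≡ interval 0 t ++ interval (t + M) (n ∸ t)
raise-[1‥] {t} {n} M t≤n = begin
  map (raise t M) (interval 0 n)
    ≡⟨ cong (map (raise t M) ∘ interval 0) (sym (m+[n∸m]≡n t≤n)) ⟩
  map (raise t M) (interval 0 (t + (n ∸ t)))
    ≡⟨ cong (map (raise t M)) (interval-++ 0 t (n ∸ t)) ⟩
  map (raise t M) (interval 0 t ++ interval t (n ∸ t))
    ≡⟨ map-++ (raise t M) (interval 0 t) (interval t (n ∸ t)) ⟩
  map (raise t M) (interval 0 t) ++ map (raise t M) (interval t (n ∸ t))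
    ≡⟨ cong₂ _++_ (raise-interval-fix t M 0 t ≤-refl) (raise-interval-shift t M t (n ∸ t) ≤-refl) ⟩
  interval 0 t ++ interval (t + M) (n ∸ t) ∎
  where open ≡-Reasoning

intervals-concat : ∀ {t n} M → t ≤ n →
  interval 0 t ++ interval t M ++ interval (t + M) (n ∸ t) ≡ interval 0 (M + n)
intervals-concat {t} {n} M t≤n = begin
  interval 0 t ++ interval t M ++ interval (t + M) (n ∸ t)
    ≡⟨ cong (interval 0 t ++_) (sym (interval-++ t M (n ∸ t))) ⟩
  interval 0 t ++ interval t (M + (n ∸ t))
    ≡⟨ sym (interval-++ 0 t (M + (n ∸ t))) ⟩
  interval 0 (t + (M + (n ∸ t)))
    ≡⟨ cong (interval 0) (trans (+-comm t (M + (n ∸ t))) (trans (+-assoc M (n ∸ t) t)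
         (cong (M +_) (trans (+-comm (n ∸ t) t) (m+[n∸m]≡n t≤n))))) ⟩
  interval 0 (M + n) ∎
  where open ≡-Reasoning

-- The product of α and β cut after the first t entries of β; α ⊗ β cuts at t = |T(β)|.
splice : ℕ → List ℕ → List ℕ → List ℕ
splice t α β = take t β′ ++ plus t α ++ drop t β′
  where β′ = shiftFrom (suc t) (length α) β

splice-perm : ∀ {m n t α β} → t ≤ n → α ↭ [1‥ m ] → β ↭ [1‥ n ] → splice t α β ↭ [1‥ m + n ]
splice-perm {m} {n} {t} {α} {β} t≤n α↭ β↭ = begin
  take t β′ ++ plus t α ++ drop t β′
    ↭⟨ shifts (take t β′) (plus t α) ⟩
  plus t α ++ take t β′ ++ drop t β′
    ≡⟨ cong (plus t α ++_) (take++drop≡id t β′) ⟩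
  plus t α ++ map (raise t M) β
    ↭⟨ Perm.++⁺ (Perm.map⁺ (_+ t) α↭′) (Perm.map⁺ (raise t M) β↭′) ⟩
  plus t (interval 0 M) ++ map (raise t M) (interval 0 n)
    ≡⟨ cong₂ _++_ (plus-interval t 0 M) (raise-[1‥] M t≤n) ⟩
  interval t M ++ interval 0 t ++ interval (t + M) (n ∸ t)
    ↭⟨ shifts (interval t M) (interval 0 t) ⟩
  interval 0 t ++ interval t M ++ interval (t + M) (n ∸ t)
    ≡⟨ intervals-concat M t≤n ⟩
  interval 0 (M + n)
    ≡⟨ cong (λ k → interval 0 (k + n)) M≡m ⟩
  interval 0 (m + n)
    ≡⟨ sym ([1‥]≡interval (m + n)) ⟩
  [1‥ m + n ] ∎
  where
  open PermutationReasoning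
  M = length α
  β′ = map (raise t M) β
  M≡m : M ≡ m
  M≡m = perm-length α↭
  α↭′ : α ↭ interval 0 M
  α↭′ = subst (α ↭_) (trans ([1‥]≡interval m) (cong (interval 0) (sym M≡m))) α↭
  β↭′ : β ↭ interval 0 n
  β↭′ = subst (β ↭_) ([1‥]≡interval n) β↭

all-take : ∀ {P : ℕ → Set} σ i → (∀ {p} → p < i → P (σ ‼ p)) → All P (take i σ)
all-take σ zero _ = []
all-take [] (suc i) _ = []
all-take (x ∷ σ) (suc i) h = h (s≤s z≤n) ∷ all-take σ i (h ∘ s≤s)

splice-avoids : ∀ {m t α β} → α ↭ [1‥ m ] → Avoids132 α → Avoids132 β →
  Exceeds β t → NoDescentAbove β t → Avoids132 (splice t α β)
splice-avoids {m} {t} {α} {β} α↭ avα avβ exceeds noDescent occ =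
  glue P A S noPS (glue₂ A S noA noS mid out increasing) high (All.map proj₂ mid) (contains⇒pattern occ)
  where
  M = length α
  β′ = map (raise t M) β
  P = take t β′
  A = plus t α
  S = drop t β′
  noPS : ¬ Pattern (P ++ S)
  noPS = subst (¬_ ∘ Pattern) (sym (take++drop≡id t β′)) (avoids-map (raise t M) raise-reflects-< avβ)
  noS : ¬ Pattern S
  noS (a , b , c , s , a<b , b<c) = noPS (a , b , c , Sublist.++⁺ (minimum P) s , a<b , b<c)
  noA : ¬ Pattern A
  noA = avoids-map (_+ t) (+-cancelʳ-< t _ _) avα
  high : All (t + M <_) P
  high = subst (All (t + M <_)) (sym (take-map t β)) (AllP.map⁺ (All.map (raise-above {t} {M}) (all-take {t <_} β t exceeds)))
  mid : All (λ x → t < x × x ≤ t + M) A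
  mid = AllP.map⁺ (All.tabulate λ x∈α → bounds (perm-range α↭ x∈α))
    where
    bounds : ∀ {x} → 0 < x × x ≤ m → t < x + t × x + t ≤ t + M
    bounds {x} (0<x , x≤m) = m<n+m t 0<x ,
      subst (x + t ≤_) (+-comm M t) (+-monoˡ-≤ t (subst (x ≤_) (sym (perm-length α↭)) x≤m))
  out : All (λ x → x ≤ t ⊎ t + M < x) S
  out = AllP.drop⁺ t (AllP.map⁺ (All.universal (raise-gap t M) β))
  increasing : ∀ {c b} → (c ∷ b ∷ []) ⊆ S → t + M < b → b < c → ⊥
  increasing s M<b b<c with head-after t β′ s
  ... | p , t≤p , _ , refl , s′ with head-after (suc p) β′ s′
  ... | q , p<q , q< , refl , _ = noDescent t≤p p<q q<β
    (raise-large (subst (t + M <_) (‼-map (raise t M) β q<β) M<b))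
    (raise-reflects-< (subst₂ _<_ (‼-map (raise t M) β q<β) (‼-map (raise t M) β (<-trans p<q q<β)) b<c))
    where q<β = subst (q <_) (length-map (raise t M) β) q<

proposition3p2 : (m n : ℕ) (α β : List ℕ) → InS132 m α → InS132 n β →
    InS132 (m + n) (α ⊗ β)
proposition3p2 m n α β (α↭ , avα) (β↭ , avβ) =
  splice-perm (InitialRun.bounded run) α↭ β↭ ,
  splice-avoids α↭ avα avβ (run⇒exceeds β↭ avβ run) (run⇒noDescent β↭ avβ run)
  where
  run : InitialRun (InT β ∘ suc) n (length (T β))
  run = T-run β↭ avβ
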